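{- For every $\kappa\geq 1$ and $\delta\geq 1$, the total update time of the incremental algorithm $\mathcal{A}$ (described in the context) over $q$ edge insertions is $$O\!\left(T_{\mathrm{BFS}}(X)\cdot\left(\frac{q}{\kappa}+\frac{nX}{\delta^2}+1\right)+q\right),$$ where $T_{\mathrm{BFS}}(X)$ is the time needed to compute a BFS tree up to depth $X$ and $n=|V|$.
   Context: Let $G$ be an unweighted undirected graph on a fixed node set $V$ of size $n$ with root $s$, initially connected, undergoing $q$ edge insertions; $G$ denotes the current graph. Algorithm $\mathcal{A}$ has parameters $\kappa,\delta,X$ and works in phases. At the start of each phase (and initially) it lets $G_0$ denote the current graph, computes a BFS tree of $G_0$ rooted at $s$ up to depth $X$ together with the distances $d_{G_0}(\cdot,s)$ (costing $T_{\mathrm{BFS}}(X)$), and resets a counter $k$ to $0$. When an edge $(u,v)$ is inserted (with endpoints named so that $d_{G_0}(u,s)\geq d_{G_0}(v,s)$), it spends constant time, increments $k$; if $k$ reaches $\kappa$ it starts a new phase; and if $d_{G_0}(u,s)>d_{G_0}(v,s)+\delta$ it starts a new phase. -}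

module Defs where

open import Data.Nat using (ℕ; zero; suc; _+_; _*_; _≤_; _<ᵇ_; _≡ᵇ_)
open import Data.Bool using (Bool; true; false; _∧_; _∨_; if_then_else_)
open import Data.Fin using (Fin)
open import Data.Fin.Properties using (_≟_)
open import Data.List using (List; []; _∷_; length)
open import Data.Bool.ListAction using (any)
open import Data.List.Base using (allFin)
open import Data.Product using (_×_; _,_; ∃)
open import Relation.Nullary.Decidable using (⌊_⌋)
open import Relation.Binary.PropositionalEquality using (_≡_)

-- An undirected (multi)graph on the node set Fin n, given by its edge list.
Edge : ℕ → Set
Edge n = Fin n × Fin n

Graph : ℕ → Set
Graph n = List (Edge n)

adj : ∀ {n} → Graph n → Fin n → Fin n → Bool
adj E x y = any (λ { (a , b) → (⌊ a ≟ x ⌋ ∧ ⌊ b ≟ y ⌋) ∨ (⌊ a ≟ y ⌋ ∧ ⌊ b ≟ x ⌋) }) E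

-- BFS layers: reach E s k w = true iff d_E(w,s) ≤ k
reach : ∀ {n} → Graph n → Fin n → ℕ → Fin n → Bool
reach {n} E s zero    w = ⌊ w ≟ s ⌋
reach {n} E s (suc k) w = reach E s k w ∨ any (λ x → reach E s k x ∧ adj E x w) (allFin n)

Connected : ∀ {n} → Graph n → Fin n → Set
Connected {n} E s = ∀ (w : Fin n) → ∃ λ k → reach E s k w ≡ true

-- Distances produced by a BFS from s up to depth X:
-- truncDist E s X w = d_E(w,s) if d_E(w,s) ≤ X, and X+1 (“beyond depth X”) otherwise.
truncDistFrom : ∀ {n} → Graph n → Fin n → ℕ → ℕ → Fin n → ℕ
truncDistFrom E s i zero    w = if reach E s i w then i else suc i
truncDistFrom E s i (suc r) w = if reach E s i w then i else truncDistFrom E s (suc i) r w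

truncDist : ∀ {n} → Graph n → Fin n → ℕ → Fin n → ℕ
truncDist E s X w = truncDistFrom E s 0 X w

-- Phase-start test on insertion of edge (a,b) w.r.t. the phase graph G0:
-- name endpoints so that d(u) ≥ d(v), then test d(u) > d(v) + δ.
farEdge : ∀ {n} → Graph n → Fin n → ℕ → ℕ → Edge n → Bool
farEdge G0 s X δ (a , b) =
  let da = truncDist G0 s X a
      db = truncDist G0 s X b
  in if db Data.Nat.≤ᵇ da then (db + δ) <ᵇ da else (da + δ) <ᵇ db

-- Number of new phases (i.e. BFS recomputations) started while processing the
-- insertion sequence, given phase graph G0, current graph G, counter k.
newPhases : ∀ {n} → Fin n → (κ δ X : ℕ) → Graph n → Graph n → ℕ → List (Edge n) → ℕ
newPhases s κ δ X G0 G k [] = 0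
newPhases s κ δ X G0 G k (e ∷ rest) =
  let G' = e ∷ G in
  if (suc k ≡ᵇ κ) ∨ farEdge G0 s X δ e
    then suc (newPhases s κ δ X G' G' 0 rest)
    else newPhases s κ δ X G0 G' (suc k) rest

-- Total update time of algorithm A: T_BFS(X) per BFS computation (the initial
-- one plus one per new phase), plus constant (unit) time per insertion.
totalTime : ∀ {n} → Fin n → (κ δ X : ℕ) → (TBFS : ℕ → ℕ) → Graph n → List (Edge n) → ℕ
totalTime s κ δ X TBFS G ins =
  TBFS X * suc (newPhases s κ δ X G G 0 ins) + length ins

-- A costs T_BFS(X) per phase plus one unit per insertion, so the theorem reduces to
-- bounding the number N of phases after the first: N·κδ² ≤ q·δ² + 18·n·X·κ.
-- A phase ends when κ insertions have been counted, or when an inserted edge (v,u) is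
-- far, i.e. td(u) > td(v) + δ for the distances td of the phase graph G0 reported by a
-- BFS up to depth X (the true distance, capped at X+1). The potential Φ(G) = Σ_w td_G(w)
-- never increases under insertions and is at most n(X+1). After a far insertion u is
-- within td(v)+1 of s; walking back from u along BFS parents of G0 gives J+1 distinct
-- vertices whose reported distance drops by at least J+1 each, where 3J+1 ≤ δ ≤ 3J+3,
-- so 9Φ drops by at least δ². Charging κδ² per phase then yields the bound.
module Submission where

open import Defs
open import Data.Nat using (ℕ; zero; suc; _+_; _*_; _∸_; _⊓_; _≤_; _<_; _≤′_; z≤n; s≤s; ≤′-refl; ≤′-step; _≤ᵇ_; _≡ᵇ_)
open import Data.Nat.Properties hiding (_≟_)
open import Data.Nat.ListAction using (sum)
open import Data.Nat.ListAction.Properties using (sum-++)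
open import Data.Nat.Tactic.RingSolver using (solve-∀)
open import Algebra.Properties.CommutativeSemigroup +-commutativeSemigroup using (interchange; x∙yz≈y∙xz)
open import Data.Bool using (Bool; true; false; T; _∧_; _∨_)
open import Data.Bool.Properties using (T-≡; T-∧; T-∨)
open import Data.Bool.ListAction using (any)
open import Data.Fin using (Fin)
open import Data.Fin.Properties using (_≟_)
open import Data.List using (List; []; _∷_; _++_; [_]; length; map; allFin)
open import Data.List.Properties using (map-++; length-tabulate)
open import Data.List.Membership.Propositional using (find; lose)
open import Data.List.Membership.Propositional.Properties using (∈-allFin; ∈-∃++; ∈-++⁻; ∈-++⁺ˡ; ∈-++⁺ʳ)
open import Data.List.Relation.Binary.Subset.Propositional using (_⊆_)
import Data.List.Relation.Binary.Subset.Propositional.Properties as Subset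
open import Data.List.Relation.Unary.Any using (here; there)
import Data.List.Relation.Unary.Any as Any
open import Data.List.Relation.Unary.Any.Properties using (any⁺; any⁻)
open import Data.List.Relation.Unary.All using (All; []; _∷_)
import Data.List.Relation.Unary.All as All
open import Data.List.Relation.Unary.AllPairs using ([]; _∷_)
open import Data.List.Relation.Unary.Unique.Propositional using (Unique)
open import Data.Product using (_×_; _,_; ∃; proj₁; proj₂)
open import Data.Sum using (_⊎_; inj₁; inj₂)
import Data.Sum as Sum
open import Data.Empty using (⊥; ⊥-elim)
open import Function using (_∘_; id)
open import Function.Bundles using (Equivalence)
open import Relation.Nullary using (¬_; yes; no; contradiction)
open import Relation.Nullary.Decidable using (T?; fromWitness; ⌊_⌋)
open import Relation.Binary.PropositionalEquality using (_≡_; _≢_; refl; sym; trans; cong; cong₂; subst; module ≡-Reasoning)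

module Adjacency {n : ℕ} where

  ⊆-insert : ∀ {E E' : Graph n} {e} → E ⊆ E' → E ⊆ e ∷ E'
  ⊆-insert {E' = E'} {e} E⊆E' = Subset.⊆-trans E⊆E' (Subset.xs⊆x∷xs E' e)

  adj-⊆ : {E E' : Graph n} → E ⊆ E' → ∀ {x y} → T (adj E x y) → T (adj E' x y)
  adj-⊆ E⊆E' = Subset.any⁺ _ E⊆E'

  joins : Fin n → Fin n → Edge n → Bool
  joins x y (a , b) = (⌊ a ≟ x ⌋ ∧ ⌊ b ≟ y ⌋) ∨ (⌊ a ≟ y ⌋ ∧ ⌊ b ≟ x ⌋)

  adj-sym : (E : Graph n) → ∀ {x y} → T (adj E x y) → T (adj E y x)
  adj-sym E {x} {y} = any⁺ (joins y x) ∘ Any.map (λ {e} → joins-sym e) ∘ any⁻ (joins x y) E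
    where
    joins-sym : ∀ e → T (joins x y e) → T (joins y x e)
    joins-sym (a , b) = Equivalence.from (T-∨ {⌊ a ≟ y ⌋ ∧ ⌊ b ≟ x ⌋}) ∘ Sum.swap ∘ Equivalence.to T-∨

  adj-new : (E : Graph n) (a b : Fin n) → T (adj ((a , b) ∷ E) a b)
  adj-new E a b = Equivalence.from (T-∨ {joins a b (a , b)}) (inj₁ (Equivalence.from T-∨ (inj₁
                    (Equivalence.from T-∧ (fromWitness {a? = a ≟ a} refl , fromWitness {a? = b ≟ b} refl)))))

module Layers {n : ℕ} (s : Fin n) where
  open Adjacency

  -- w lies within distance k of s in E (the k-th BFS layer, cumulatively).
  -- (A record, so that E, k and w can be inferred from a proof.)
  record Within (E : Graph n) (k : ℕ) (w : Fin n) : Set where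
    constructor within
    field reaches : T (reach E s k w)
  open Within

  within-suc : ∀ {E k w} → Within E k w → Within E (suc k) w
  within-suc h = within (Equivalence.from T-∨ (inj₁ (reaches h)))

  within-step : ∀ {E k x w} → Within E k x → T (adj E x w) → Within E (suc k) w
  within-step {E} {k} {x} {w} hx a = within (Equivalence.from T-∨ (inj₂
    (any⁺ (λ z → reach E s k z ∧ adj E z w) (lose (∈-allFin x) (Equivalence.from T-∧ (reaches hx , a))))))

  within-back : ∀ {E k w} → Within E (suc k) w →
                Within E k w ⊎ ∃ λ x → Within E k x × T (adj E x w)
  within-back {E} {k} {w} = Sum.map within predecessor ∘ Equivalence.to T-∨ ∘ reaches
    where
    predecessor : T (any (λ z → reach E s k z ∧ adj E z w) (allFin n)) → ∃ λ x → Within E k x × T (adj E x w)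
    predecessor h with find (any⁻ _ (allFin n) h)
    ... | x , _ , px = let rx , a = Equivalence.to T-∧ px in x , within rx , a

  within-≤ : ∀ {E i j w} → i ≤ j → Within E i w → Within E j w
  within-≤ i≤j = go (≤⇒≤′ i≤j)
    where
    go : ∀ {E i j w} → i ≤′ j → Within E i w → Within E j w
    go ≤′-refl h = h
    go (≤′-step i≤′j) h = within-suc (go i≤′j h)

  within-⊆ : ∀ {E E' k w} → E ⊆ E' → Within E k w → Within E' k w
  within-⊆ {k = zero} _ (within h) = within h
  within-⊆ {k = suc k} E⊆E' h with within-back h
  ... | inj₁ hk = within-suc (within-⊆ E⊆E' hk)
  ... | inj₂ (x , hx , a) = within-step (within-⊆ E⊆E' hx) (adj-⊆ E⊆E' a)

  connected-within : ∀ {E} → Connected E s → ∀ w → ∃ λ k → Within E k w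
  connected-within {E} conn w with conn w
  ... | k , h = k , within {E} {k} {w} (Equivalence.from T-≡ h)

  connected-⊆ : ∀ {E E'} → E ⊆ E' → Connected E s → Connected E' s
  connected-⊆ E⊆E' conn w with connected-within conn w
  ... | k , h = k , Equivalence.to T-≡ (reaches (within-⊆ E⊆E' h))

  AtDist : Graph n → ℕ → Fin n → Set
  AtDist E D w = Within E D w × (∀ {i} → i < D → ¬ Within E i w)

  atDist-unique : ∀ {E D D' w} → AtDist E D w → AtDist E D' w → D ≡ D'
  atDist-unique (hD , belowD) (hD' , belowD') =
    ≤-antisym (≮⇒≥ (λ D'<D → belowD D'<D hD')) (≮⇒≥ (λ D<D' → belowD' D<D' hD))

  atDist-exists : ∀ {E k w} → Within E k w → ∃ λ D → D ≤ k × AtDist E D w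
  atDist-exists {k = zero} h = zero , z≤n , h , λ ()
  atDist-exists {E} {suc k} {w} h with T? (reach E s k w)
  ... | yes hk = let D , D≤k , d = atDist-exists (within hk) in D , m≤n⇒m≤1+n D≤k , d
  ... | no ¬hk = suc k , ≤-refl , h , λ i<1+k hi → ¬hk (reaches (within-≤ (≤-pred i<1+k) hi))

  distance : ∀ {E} → Connected E s → ∀ w → ∃ λ D → AtDist E D w
  distance conn w with atDist-exists (proj₂ (connected-within conn w))
  ... | D , _ , d = D , d

  atDist-parent : ∀ {E D w} → AtDist E (suc D) w → ∃ λ x → AtDist E D x × T (adj E x w)
  atDist-parent (h , below) with within-back h
  ... | inj₁ hD = contradiction hD (below ≤-refl)
  ... | inj₂ (x , hx , a) = x , (hx , λ i<D hi → below (s≤s i<D) (within-step hi a)) , a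

module Truncated {n : ℕ} (s : Fin n) (X : ℕ) where
  open Layers s

  td : Graph n → Fin n → ℕ
  td E w = truncDist E s X w

  layer-hit : ∀ {E D w i} → AtDist E D w → i ≤ D → reach E s i w ≡ true → i ≡ D
  layer-hit (_ , below) i≤D hit =
    ≤-antisym i≤D (≮⇒≥ (λ i<D → below i<D (within (Equivalence.from T-≡ hit))))

  layer-miss : ∀ {E D w i} → AtDist E D w → i ≤ D → reach E s i w ≡ false → i < D
  layer-miss (hD , _) i≤D miss with m≤n⇒m<n∨m≡n i≤D
  ... | inj₁ i<D = i<D
  ... | inj₂ refl with () ← trans (sym miss) (Equivalence.to T-≡ (Within.reaches hD))

  truncDistFrom-atDist : ∀ {E D w i} → AtDist E D w → i ≤ D → ∀ r →
                         truncDistFrom E s i r w ≡ D ⊓ suc (r + i)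
  truncDistFrom-atDist {E} {D} {w} {i} d i≤D zero with reach E s i w in eq
  ... | true with refl ← layer-hit d i≤D eq = sym (m≤n⇒m⊓n≡m (n≤1+n i))
  ... | false = sym (m≥n⇒m⊓n≡n (layer-miss d i≤D eq))
  truncDistFrom-atDist {E} {D} {w} {i} d i≤D (suc r) with reach E s i w in eq
  ... | true with refl ← layer-hit d i≤D eq = sym (m≤n⇒m⊓n≡m (m≤n⇒m≤1+n (m≤n+m i (suc r))))
  ... | false = begin
    truncDistFrom E s (suc i) r w ≡⟨ truncDistFrom-atDist d (layer-miss d i≤D eq) r ⟩
    D ⊓ suc (r + suc i)           ≡⟨ cong (λ m → D ⊓ suc m) (+-suc r i) ⟩
    D ⊓ suc (suc r + i)           ∎
    where open ≡-Reasoning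

  td-atDist : ∀ {E D w} → AtDist E D w → td E w ≡ D ⊓ suc X
  td-atDist {D = D} d = trans (truncDistFrom-atDist d z≤n X) (cong (λ m → D ⊓ suc m) (+-identityʳ X))

  td-≤-dist : ∀ {E D w} → AtDist E D w → td E w ≤ D
  td-≤-dist {D = D} d = ≤-trans (≤-reflexive (td-atDist d)) (m⊓n≤m D (suc X))

  td-≤-within : ∀ {E k w} → Within E k w → td E w ≤ k
  td-≤-within h with atDist-exists h
  ... | D , D≤k , d = ≤-trans (td-≤-dist d) D≤k

  td-≤-cap : ∀ {E} → Connected E s → ∀ w → td E w ≤ suc X
  td-≤-cap conn w with distance conn w
  ... | D , d = ≤-trans (≤-reflexive (td-atDist d)) (m⊓n≤n D (suc X))

  td-exact : ∀ {E D w} → AtDist E D w → td E w ≤ X → td E w ≡ D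
  td-exact {D = D} d td≤X with ≤-total D (suc X)
  ... | inj₁ D≤1+X = trans (td-atDist d) (m≤n⇒m⊓n≡m D≤1+X)
  ... | inj₂ 1+X≤D = contradiction (≤-trans (≤-reflexive (sym (trans (td-atDist d) (m≥n⇒m⊓n≡n 1+X≤D)))) td≤X) 1+n≰n

  td-⊆ : ∀ {E E'} → Connected E s → E ⊆ E' → ∀ w → td E' w ≤ td E w
  td-⊆ {E} {E'} conn E⊆E' w with distance conn w
  ... | D , d with atDist-exists (within-⊆ E⊆E' (proj₁ d))
  ... | D' , D'≤D , d' = begin
    td E' w     ≡⟨ td-atDist d' ⟩
    D' ⊓ suc X  ≤⟨ ⊓-monoˡ-≤ (suc X) D'≤D ⟩
    D ⊓ suc X   ≡⟨ td-atDist d ⟨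
    td E w      ∎
    where open ≤-Reasoning

module BackwardPath {n : ℕ} (s : Fin n) where
  open Adjacency
  open Layers s

  OnPath : (G0 G' : Graph n) (D r t : ℕ) → Fin n → Set
  OnPath G0 G' D r t w = ∃ λ i → i ≤ t × AtDist G0 (D ∸ i) w × Within G' (i + r) w

  backward-path : ∀ {G0 G' D r u} → G0 ⊆ G' → AtDist G0 D u → Within G' r u → ∀ t → t ≤ D →
                  ∃ λ L → length L ≡ suc t × Unique L × All (OnPath G0 G' D r t) L
  backward-path {u = u} _ d h zero _ = [ u ] , refl , [] ∷ [] , (zero , z≤n , d , h) ∷ []
  backward-path {G0} {G'} {suc D} {r} {u} G0⊆G' d h (suc t) (s≤s t≤D) with atDist-parent d
  ... | x , dx , x~u with backward-path G0⊆G' dx (within-step h (adj-⊆ G0⊆G' (adj-sym G0 x~u))) t t≤D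
  ... | L , len , unique , onPath =
    u ∷ L , cong suc len , All.map u-fresh onPath ∷ unique , (zero , z≤n , d , h) ∷ All.map shift onPath
    where
    shift : ∀ {w} → OnPath G0 G' D (suc r) t w → OnPath G0 G' (suc D) r (suc t) w
    shift {w} (i , i≤t , dw , hw) = suc i , s≤s i≤t , dw , subst (λ k → Within G' k w) (+-suc i r) hw

    -- u is strictly farther from s in G0 than every later vertex.
    u-fresh : ∀ {w} → OnPath G0 G' D (suc r) t w → u ≢ w
    u-fresh (i , _ , dw , _) refl = <⇒≢ (s≤s (m∸n≤m D i)) (sym (atDist-unique d dw))

module Sums {A : Set} where

  sum-map-mono : ∀ {f g : A → ℕ} → (∀ x → f x ≤ g x) → ∀ xs → sum (map f xs) ≤ sum (map g xs)
  sum-map-mono f≤g []       = z≤n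
  sum-map-mono f≤g (x ∷ xs) = +-mono-≤ (f≤g x) (sum-map-mono f≤g xs)

  sum-map-≤-const : ∀ {f : A → ℕ} {B} → (∀ x → f x ≤ B) → ∀ xs → sum (map f xs) ≤ length xs * B
  sum-map-≤-const f≤B []       = z≤n
  sum-map-≤-const f≤B (x ∷ xs) = +-mono-≤ (f≤B x) (sum-map-≤-const f≤B xs)

  sum-map-≥-const : ∀ {f : A → ℕ} {B xs} → All (λ x → B ≤ f x) xs → length xs * B ≤ sum (map f xs)
  sum-map-≥-const []           = z≤n
  sum-map-≥-const (B≤fx ∷ B≤f) = +-mono-≤ B≤fx (sum-map-≥-const B≤f)

  sum-map-∸ : ∀ {f g : A → ℕ} → (∀ x → g x ≤ f x) → ∀ xs →
              sum (map g xs) + sum (map (λ x → f x ∸ g x) xs) ≡ sum (map f xs)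
  sum-map-∸ g≤f []       = refl
  sum-map-∸ {f} {g} g≤f (x ∷ xs) =
    trans (interchange (g x) _ (f x ∸ g x) _) (cong₂ _+_ (m+[n∸m]≡n (g≤f x)) (sum-map-∸ g≤f xs))

  sum-map-⊆ : ∀ (f : A → ℕ) {L B} → Unique L → L ⊆ B → sum (map f L) ≤ sum (map f B)
  sum-map-⊆ f {[]}    _             _   = z≤n
  sum-map-⊆ f {x ∷ L} (x∉L ∷ uniqueL) L⊆B with ∈-∃++ (L⊆B (here refl))
  ... | ys , zs , refl = begin
    f x + sum (map f L)                        ≤⟨ +-monoʳ-≤ (f x) (sum-map-⊆ f uniqueL L⊆ys++zs) ⟩
    f x + sum (map f (ys ++ zs))               ≡⟨ cong (f x +_) (sum-map-++ ys zs) ⟩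
    f x + (sum (map f ys) + sum (map f zs))    ≡⟨ x∙yz≈y∙xz (f x) (sum (map f ys)) (sum (map f zs)) ⟩
    sum (map f ys) + sum (map f (x ∷ zs))      ≡⟨ sum-map-++ ys (x ∷ zs) ⟨
    sum (map f (ys ++ x ∷ zs))                 ∎
    where
    open ≤-Reasoning
    sum-map-++ : ∀ us vs → sum (map f (us ++ vs)) ≡ sum (map f us) + sum (map f vs)
    sum-map-++ us vs = trans (cong sum (map-++ f us vs)) (sum-++ (map f us) (map f vs))

    L⊆ys++zs : L ⊆ ys ++ zs
    L⊆ys++zs {z} z∈L with ∈-++⁻ ys (L⊆B (there z∈L))
    ... | inj₁ z∈ys         = ∈-++⁺ˡ z∈ys
    ... | inj₂ (here refl)  = contradiction refl (All.lookup x∉L z∈L)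
    ... | inj₂ (there z∈zs) = ∈-++⁺ʳ ys z∈zs

module Potential {n : ℕ} (s : Fin n) (X : ℕ) where
  open Layers s
  open Truncated s X
  open BackwardPath s
  open Sums

  Φ : Graph n → ℕ
  Φ E = sum (map (td E) (allFin n))

  Φ-⊆ : ∀ {E E'} → Connected E s → E ⊆ E' → Φ E' ≤ Φ E
  Φ-⊆ conn E⊆E' = sum-map-mono (td-⊆ conn E⊆E') (allFin n)

  Φ-≤ : ∀ {E} → Connected E s → Φ E ≤ n * suc X
  Φ-≤ {E} conn = subst (λ m → Φ E ≤ m * suc X) (length-tabulate {n = n} id)
                   (sum-map-≤-const (td-≤-cap conn) (allFin n))

  -- The i-th vertex w on the walk back from u (at G0-distance D) drops from at least
  -- min(D, X+1) ∸ i to at most i + r, hence by at least g when the margin allows it.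
  onPath-drop : ∀ {G0 G' D r t g w} → g + (t + (t + r)) ≤ D ⊓ suc X →
                OnPath G0 G' D r t w → g ≤ td G0 w ∸ td G' w
  onPath-drop {G0} {G'} {D} {r} {t} {g} {w} margin (i , i≤t , dw , hw) = begin
    g                                   ≤⟨ m+n≤o⇒m≤o∸n g margin ⟩
    D ⊓ suc X ∸ (t + (t + r))           ≤⟨ ∸-monoʳ-≤ (D ⊓ suc X) (+-mono-≤ i≤t (+-monoˡ-≤ r i≤t)) ⟩
    D ⊓ suc X ∸ (i + (i + r))           ≡⟨ ∸-+-assoc (D ⊓ suc X) i (i + r) ⟨
    D ⊓ suc X ∸ i ∸ (i + r)             ≤⟨ ∸-mono old-lower (td-≤-within hw) ⟩
    td G0 w ∸ td G' w                   ∎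
    where
    open ≤-Reasoning
    old-lower : D ⊓ suc X ∸ i ≤ td G0 w
    old-lower = begin
      D ⊓ suc X ∸ i              ≡⟨ ∸-distribʳ-⊓ i D (suc X) ⟩
      (D ∸ i) ⊓ (suc X ∸ i)      ≤⟨ ⊓-monoʳ-≤ (D ∸ i) (m∸n≤m (suc X) i) ⟩
      (D ∸ i) ⊓ suc X            ≡⟨ td-atDist dw ⟨
      td G0 w                    ∎

  -- If u is within r in a supergraph G' but reported at td G0 u ≥ r + 3t + 1 in G0,
  -- then t+1 vertices on its shortest path each drop by t+1, so Φ drops by (t+1)².
  path-drop : ∀ {G0 G' D r u} → Connected G0 s → G0 ⊆ G' → AtDist G0 D u → Within G' r u →
              ∀ t → suc t + (t + (t + r)) ≤ td G0 u → Φ G' + suc t * suc t ≤ Φ G0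
  path-drop {G0} {G'} {D} {r} {u} conn G0⊆G' du hu t margin
    with backward-path G0⊆G' du hu t (≤-trans (n≤1+n t) (≤-trans (m+n≤o⇒m≤o (suc t) margin) (td-≤-dist du)))
  ... | L , len , uniqueL , onPath = begin
    Φ G' + suc t * suc t                  ≡⟨ cong (λ m → Φ G' + m * suc t) len ⟨
    Φ G' + length L * suc t               ≤⟨ +-monoʳ-≤ (Φ G') (sum-map-≥-const (All.map drop onPath)) ⟩
    Φ G' + sum (map gain L)               ≤⟨ +-monoʳ-≤ (Φ G') (sum-map-⊆ gain uniqueL (λ {w} _ → ∈-allFin w)) ⟩
    Φ G' + sum (map gain (allFin n))      ≡⟨ sum-map-∸ (td-⊆ conn G0⊆G') (allFin n) ⟩
    Φ G0                                  ∎
    where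
    open ≤-Reasoning
    gain : Fin n → ℕ
    gain w = td G0 w ∸ td G' w

    drop : ∀ {w} → OnPath G0 G' D r t w → suc t ≤ gain w
    drop = onPath-drop (≤-trans margin (≤-reflexive (td-atDist du)))

thirds : ∀ δ → 1 ≤ δ → ∃ λ J → J * 3 + 1 ≤ δ × δ ≤ suc J * 3
thirds 1 _ = 0 , ≤-refl , s≤s z≤n
thirds 2 _ = 0 , s≤s z≤n , s≤s (s≤s z≤n)
thirds 3 _ = 0 , s≤s z≤n , ≤-refl
thirds (suc (suc (suc δ@(suc _)))) _ with thirds δ (s≤s z≤n)
... | J , lower , upper = suc J , s≤s (s≤s (s≤s lower)) , s≤s (s≤s (s≤s upper))

module FarEdges {n : ℕ} (s : Fin n) (X δ : ℕ) where
  open Adjacency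
  open Layers s
  open Truncated s X
  open Potential s X

  far-orient : ∀ {G0} a b → T (farEdge G0 s X δ (a , b)) →
               td G0 b + δ < td G0 a ⊎ td G0 a + δ < td G0 b
  far-orient {G0} a b far with td G0 b ≤ᵇ td G0 a
  ... | true  = inj₁ (<ᵇ⇒< _ _ far)
  ... | false = inj₂ (<ᵇ⇒< _ _ far)

  -- Joining v to a vertex u that G0 reports more than δ deeper lowers 9Φ by at least δ²:
  -- u is now within td G0 v + 1, so path-drop applies with t = J where 3J+1 ≤ δ ≤ 3J+3.
  edge-drop : ∀ {G0 G' u v} → 1 ≤ δ → Connected G0 s → G0 ⊆ G' → T (adj G' v u) →
              td G0 v + δ < td G0 u → 9 * Φ G' + δ * δ ≤ 9 * Φ G0
  edge-drop {G0} {G'} {u} {v} 1≤δ conn G0⊆G' v~u far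
    with thirds δ 1≤δ | distance conn v | distance conn u
  ... | J , 3J+1≤δ , δ≤3J+3 | Dv , dv | Du , du = begin
    9 * Φ G' + δ * δ                  ≤⟨ +-monoʳ-≤ (9 * Φ G') δ²≤9[J+1]² ⟩
    9 * Φ G' + 9 * (suc J * suc J)    ≡⟨ *-distribˡ-+ 9 (Φ G') (suc J * suc J) ⟨
    9 * (Φ G' + suc J * suc J)        ≤⟨ *-monoʳ-≤ 9 (path-drop conn G0⊆G' du u-near J margin) ⟩
    9 * Φ G0                          ∎
    where
    open ≤-Reasoning
    δ²≤9[J+1]² : δ * δ ≤ 9 * (suc J * suc J)
    δ²≤9[J+1]² = ≤-trans (*-mono-≤ δ≤3J+3 δ≤3J+3) (≤-reflexive (square J))
      where
      square : ∀ J → suc J * 3 * (suc J * 3) ≡ 9 * (suc J * suc J)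
      square = solve-∀

    -- v is reported strictly below the cap, so its reported distance is exact.
    tdv≡Dv : td G0 v ≡ Dv
    tdv≡Dv = td-exact dv (≤-pred (≤-trans (s≤s (m≤m+n (td G0 v) δ)) (≤-trans far (td-≤-cap conn u))))

    u-near : Within G' (suc Dv) u
    u-near = within-step (within-⊆ G0⊆G' (proj₁ dv)) v~u

    margin : suc J + (J + (J + suc Dv)) ≤ td G0 u
    margin = begin
      suc J + (J + (J + suc Dv))  ≡⟨ regroup J Dv ⟩
      suc (Dv + (J * 3 + 1))      ≤⟨ s≤s (+-monoʳ-≤ Dv 3J+1≤δ) ⟩
      suc (Dv + δ)                ≡⟨ cong (λ m → suc (m + δ)) tdv≡Dv ⟨
      suc (td G0 v + δ)           ≤⟨ far ⟩
      td G0 u                     ∎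
      where
      regroup : ∀ J D → suc J + (J + (J + suc D)) ≡ suc (D + (J * 3 + 1))
      regroup = solve-∀

  far-drop : ∀ {G0 E} e → 1 ≤ δ → Connected G0 s → G0 ⊆ E → T (farEdge G0 s X δ e) →
             9 * Φ (e ∷ E) + δ * δ ≤ 9 * Φ G0
  far-drop {G0} {E} (a , b) 1≤δ conn G0⊆E far with far-orient a b far
  ... | inj₁ b-shallow = edge-drop 1≤δ conn (⊆-insert G0⊆E) (adj-sym ((a , b) ∷ E) (adj-new E a b)) b-shallow
  ... | inj₂ a-shallow = edge-drop 1≤δ conn (⊆-insert G0⊆E) (adj-new E a b) a-shallow

  gap-too-small : ∀ {x y} → 1 ≤ δ → x + δ < y → y ≤ 1 → ⊥
  gap-too-small {x} 1≤δ x+δ<y y≤1 with ≤-trans 1≤δ (m+n≤o⇒n≤o x (≤-pred (≤-trans x+δ<y y≤1)))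
  ... | ()

  -- With depth X = 0 every reported distance is 0 or 1, so no edge is far.
  no-far-edge : ∀ {G0} e → X ≡ 0 → 1 ≤ δ → Connected G0 s → ¬ T (farEdge G0 s X δ e)
  no-far-edge {G0} (a , b) refl 1≤δ conn far with far-orient {G0} a b far
  ... | inj₁ b-shallow = gap-too-small 1≤δ b-shallow (td-≤-cap conn a)
  ... | inj₂ a-shallow = gap-too-small 1≤δ a-shallow (td-≤-cap conn b)

-- Amortized count of phases for any potential that never increases along a phase and
-- drops by δ² whenever a far edge is inserted: with κδ² charged per new phase,
-- the phases are paid for by δ² per insertion plus κ times the initial potential.
module Amortization {n : ℕ} (s : Fin n) (κ δ X : ℕ) (Pot : Graph n → ℕ)
  (Pot-⊆ : ∀ {E E'} → Connected E s → E ⊆ E' → Pot E' ≤ Pot E)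
  (Pot-far : ∀ {G0 E} e → Connected G0 s → G0 ⊆ E → T (farEdge G0 s X δ e) →
             Pot (e ∷ E) + δ * δ ≤ Pot G0) where
  open Adjacency
  open Layers s

  next-phase : ∀ {G0 G} e rest → Connected G0 s → G0 ⊆ G →
               newPhases s κ δ X (e ∷ G) (e ∷ G) 0 rest * (κ * (δ * δ))
                 ≤ length rest * (δ * δ) + κ * Pot (e ∷ G)

  -- Invariant along the run: in a phase with graph G0, current graph G ⊇ G0 and counter k,
  -- the remaining phases cost at most δ² per insertion counted since the phase began
  -- (k already made plus those still to come) plus κ·Pot G0.
  phases-bound : ∀ {G0 G} k rest → Connected G0 s → G0 ⊆ G →
                 newPhases s κ δ X G0 G k rest * (κ * (δ * δ)) ≤ (k + length rest) * (δ * δ) + κ * Pot G0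
  phases-bound k [] _ _ = z≤n
  phases-bound {G0} {G} k (e ∷ rest) conn G0⊆G with suc k ≡ᵇ κ in counter-full | farEdge G0 s X δ e in far
  ... | false | false = begin
    newPhases s κ δ X G0 (e ∷ G) (suc k) rest * (κ * (δ * δ))
      ≤⟨ phases-bound (suc k) rest conn (⊆-insert G0⊆G) ⟩
    (suc k + length rest) * (δ * δ) + κ * Pot G0
      ≡⟨ cong (λ m → m * (δ * δ) + κ * Pot G0) (+-suc k (length rest)) ⟨
    (k + suc (length rest)) * (δ * δ) + κ * Pot G0  ∎
    where open ≤-Reasoning
  ... | true | _ with refl ← ≡ᵇ⇒≡ (suc k) κ (Equivalence.from T-≡ counter-full) = begin
    suc k * (δ * δ) + N * (suc k * (δ * δ))
      ≤⟨ +-monoʳ-≤ (suc k * (δ * δ)) (next-phase e rest conn G0⊆G) ⟩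
    suc k * (δ * δ) + (length rest * (δ * δ) + suc k * Pot (e ∷ G))
      ≤⟨ +-monoʳ-≤ (suc k * (δ * δ)) (+-monoʳ-≤ (length rest * (δ * δ))
           (*-monoʳ-≤ (suc k) (Pot-⊆ conn (⊆-insert G0⊆G)))) ⟩
    suc k * (δ * δ) + (length rest * (δ * δ) + suc k * Pot G0)
      ≡⟨ regroup k (length rest) (δ * δ) (suc k * Pot G0) ⟩
    (k + suc (length rest)) * (δ * δ) + suc k * Pot G0  ∎
    where
    open ≤-Reasoning
    N = newPhases s (suc k) δ X (e ∷ G) (e ∷ G) 0 rest
    regroup : ∀ k q D P → suc k * D + (q * D + P) ≡ (k + suc q) * D + P
    regroup = solve-∀
  phases-bound {G0} {G} k (e ∷ rest) conn G0⊆G | false | true = begin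
    κ * (δ * δ) + N * (κ * (δ * δ))
      ≤⟨ +-monoʳ-≤ (κ * (δ * δ)) (next-phase e rest conn G0⊆G) ⟩
    κ * (δ * δ) + (length rest * (δ * δ) + κ * Pot (e ∷ G))
      ≡⟨ regroup κ (length rest) (δ * δ) (Pot (e ∷ G)) ⟩
    length rest * (δ * δ) + κ * (Pot (e ∷ G) + δ * δ)
      ≤⟨ +-mono-≤ (*-monoˡ-≤ (δ * δ) (m≤n+m (length rest) (suc k)))
                  (*-monoʳ-≤ κ (Pot-far e conn G0⊆G (Equivalence.from T-≡ far))) ⟩
    (suc k + length rest) * (δ * δ) + κ * Pot G0
      ≡⟨ cong (λ m → m * (δ * δ) + κ * Pot G0) (+-suc k (length rest)) ⟨
    (k + suc (length rest)) * (δ * δ) + κ * Pot G0  ∎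
    where
    open ≤-Reasoning
    N = newPhases s κ δ X (e ∷ G) (e ∷ G) 0 rest
    regroup : ∀ κ q D P → κ * D + (q * D + κ * P) ≡ q * D + κ * (P + D)
    regroup = solve-∀

  next-phase e rest conn G0⊆G = phases-bound 0 rest (connected-⊆ (⊆-insert G0⊆G) conn) Subset.⊆-refl

-- The potential is 9Φ, which starts below 9n(X+1) ≤ 18nX; for X = 0 no edge is far and
-- the zero potential suffices.
phase-count : ∀ {n} (s : Fin n) (G : Graph n) → Connected G s → ∀ κ δ X (ins : List (Edge n)) → 1 ≤ δ →
              newPhases s κ δ X G G 0 ins * (κ * (δ * δ)) ≤ length ins * (δ * δ) + 18 * (n * X * κ)
phase-count {n} s G conn κ δ zero ins 1≤δ = begin
  newPhases s κ δ 0 G G 0 ins * (κ * (δ * δ))  ≤⟨ phases-bound 0 ins conn Subset.⊆-refl ⟩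
  length ins * (δ * δ) + κ * 0                 ≤⟨ +-monoʳ-≤ (length ins * (δ * δ)) (≤-trans (≤-reflexive (*-zeroʳ κ)) z≤n) ⟩
  length ins * (δ * δ) + 18 * (n * 0 * κ)      ∎
  where
  open ≤-Reasoning
  open Amortization s κ δ 0 (λ _ → 0) (λ _ _ → ≤-refl)
         (λ e conn _ far → ⊥-elim (FarEdges.no-far-edge s 0 δ e refl 1≤δ conn far))
phase-count {n} s G conn κ δ (suc X) ins 1≤δ = begin
  newPhases s κ δ (suc X) G G 0 ins * (κ * (δ * δ))  ≤⟨ phases-bound 0 ins conn Subset.⊆-refl ⟩
  length ins * (δ * δ) + κ * (9 * Φ G)               ≤⟨ +-monoʳ-≤ (length ins * (δ * δ)) initial-potential ⟩
  length ins * (δ * δ) + 18 * (n * suc X * κ)        ∎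
  where
  open ≤-Reasoning
  open Potential s (suc X)
  open Amortization s κ δ (suc X) (λ E → 9 * Φ E) (λ conn E⊆E' → *-monoʳ-≤ 9 (Φ-⊆ conn E⊆E'))
         (λ e → FarEdges.far-drop s (suc X) δ e 1≤δ)
  initial-potential : κ * (9 * Φ G) ≤ 18 * (n * suc X * κ)
  initial-potential = begin
    κ * (9 * Φ G)                     ≤⟨ *-monoʳ-≤ κ (*-monoʳ-≤ 9 (Φ-≤ conn)) ⟩
    κ * (9 * (n * suc (suc X)))       ≤⟨ *-monoʳ-≤ κ (*-monoʳ-≤ 9 (*-monoʳ-≤ n (s≤s (m≤n+m (suc X) X)))) ⟩
    κ * (9 * (n * (suc X + suc X)))   ≡⟨ regroup κ n X ⟩
    18 * (n * suc X * κ)              ∎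
    where
    regroup : ∀ κ n X → κ * (9 * (n * (suc X + suc X))) ≡ 18 * (n * suc X * κ)
    regroup = solve-∀

running-time : ∀ T N q K A B → N * K ≤ A + 18 * B → (T * suc N + q) * K ≤ 18 * (T * (A + B + K) + q * K)
running-time T N q K A B N·K≤ = begin
  (T * suc N + q) * K                                           ≡⟨ expand T N q K ⟩
  T * K + T * (N * K) + q * K                                   ≤⟨ +-monoˡ-≤ (q * K) (+-monoʳ-≤ (T * K) (*-monoʳ-≤ T N·K≤)) ⟩
  T * K + T * (A + 18 * B) + q * K                              ≤⟨ m≤m+n _ (17 * (T * K + T * A + q * K)) ⟩
  T * K + T * (A + 18 * B) + q * K + 17 * (T * K + T * A + q * K)  ≡⟨ collect T q K A B ⟩
  18 * (T * (A + B + K) + q * K)                                ∎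
  where
  open ≤-Reasoning
  expand : ∀ T N q K → (T * suc N + q) * K ≡ T * K + T * (N * K) + q * K
  expand = solve-∀
  collect : ∀ T q K A B → T * K + T * (A + 18 * B) + q * K + 17 * (T * K + T * A + q * K)
                          ≡ 18 * (T * (A + B + K) + q * K)
  collect = solve-∀

-- Lemma 4: the total update time of A is O(T_BFS(X)·(q/κ + nX/δ² + 1) + q),
-- stated multiplied through by κδ², with constant 18.
lemma4 : ∃ λ (C : ℕ) →
    ∀ (n : ℕ) (s : Fin n) (G : Graph n) → Connected G s →
    ∀ (κ δ X : ℕ) (TBFS : ℕ → ℕ) (ins : List (Edge n)) →
    1 ≤ κ → 1 ≤ δ →
    totalTime s κ δ X TBFS G ins * (κ * (δ * δ))
      ≤ C * (TBFS X * (length ins * (δ * δ) + n * X * κ + κ * (δ * δ))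
             + length ins * (κ * (δ * δ)))
lemma4 = 18 , λ n s G conn κ δ X TBFS ins _ 1≤δ →
  running-time (TBFS X) (newPhases s κ δ X G G 0 ins) (length ins) (κ * (δ * δ))
               (length ins * (δ * δ)) (n * X * κ) (phase-count s G conn κ δ X ins 1≤δ)
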